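{- Let $G$ be a connected graph of order $n \ge 3$, and let $f: V(G_1) \rightarrow V(G_2)$ be any function. Then $2 \le \dim(C(G, f)) \le 2n-3$. Both bounds are sharp, i.e., each bound is attained with equality by $\dim(C(G,f))$ for some connected graph $G$ of order $n\ge 3$ and some function $f$.
   Context: All graphs are simple, undirected, and connected. For a connected graph $H$, a set $S \subseteq V(H)$ is a resolving set if for every two distinct vertices $x,y$ of $H$ there is $s \in S$ with $d_H(x,s) \neq d_H(y,s)$; the metric dimension $\dim(H)$ is the minimum cardinality of a resolving set of $H$. Given a graph $G$, let $G_1$ and $G_2$ be disjoint copies of $G$ and let $f: V(G_1)\to V(G_2)$ be a function. The functigraph $C(G,f)$ is the graph with vertex set $V(G_1)\cup V(G_2)$ and edge set $E(G_1)\cup E(G_2)\cup\{uv \mid u \in V(G_1),\ v=f(u)\}$. -}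

module Defs where

open import Data.Nat using (ℕ; zero; suc; _≤_)
open import Data.Fin using (Fin; splitAt)
open import Data.Fin.Properties using (_≟_)
open import Data.Fin.Subset using (Subset; _∈_; ∣_∣)
open import Data.Bool using (Bool; true; false)
open import Data.Sum using (_⊎_; inj₁; inj₂)
open import Data.Product using (Σ; _×_; ∃; ∃-syntax)
open import Relation.Nullary using (¬_)
open import Relation.Nullary.Decidable using (⌊_⌋)
open import Relation.Binary.PropositionalEquality using (_≡_; _≢_)

record Graph (n : ℕ) : Set where
  field
    adj   : Fin n → Fin n → Bool
    sym   : ∀ u v → adj u v ≡ adj v u
    irref : ∀ u → adj u u ≡ false
open Graph public

data Walk {n : ℕ} (G : Graph n) : Fin n → Fin n → ℕ → Set where
  here : ∀ {x} → Walk G x x zero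
  step : ∀ {x y z k} → adj G x y ≡ true → Walk G y z k → Walk G x z (suc k)

Connected : ∀ {n} → Graph n → Set
Connected G = ∀ x y → ∃[ k ] Walk G x y k

Dist : ∀ {n} → Graph n → Fin n → Fin n → ℕ → Set
Dist G x y k = Walk G x y k × (∀ m → Walk G x y m → k ≤ m)

Resolving : ∀ {n} → Graph n → Subset n → Set
Resolving {n} G S =
  ∀ (x y : Fin n) → x ≢ y →
    ∃[ s ] (s ∈ S × ∃[ a ] ∃[ b ] (Dist G x s a × Dist G y s b × a ≢ b))

IsMetricDim : ∀ {n} → Graph n → ℕ → Set
IsMetricDim {n} G d =
  (∃[ S ] (Resolving G S × ∣ S ∣ ≡ d)) × (∀ S → Resolving G S → d ≤ ∣ S ∣)

-- Functigraph C(G,f) on Fin (n + n): first n vertices = G₁, last n = G₂.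
funAdj : ∀ {n} → Graph n → (Fin n → Fin n) → Fin n ⊎ Fin n → Fin n ⊎ Fin n → Bool
funAdj G f (inj₁ u) (inj₁ v) = adj G u v
funAdj G f (inj₂ u) (inj₂ v) = adj G u v
funAdj G f (inj₁ u) (inj₂ v) = ⌊ f u ≟ v ⌋
funAdj G f (inj₂ u) (inj₁ v) = ⌊ f v ≟ u ⌋

open import Data.Nat using (_+_)

private
  funAdj-sym : ∀ {n} (G : Graph n) f a b → funAdj G f a b ≡ funAdj G f b a
  funAdj-sym G f (inj₁ u) (inj₁ v) = sym G u v
  funAdj-sym G f (inj₂ u) (inj₂ v) = sym G u v
  funAdj-sym G f (inj₁ u) (inj₂ v) = Relation.Binary.PropositionalEquality.refl
  funAdj-sym G f (inj₂ u) (inj₁ v) = Relation.Binary.PropositionalEquality.refl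

  funAdj-irr : ∀ {n} (G : Graph n) f a → funAdj G f a a ≡ false
  funAdj-irr G f (inj₁ u) = irref G u
  funAdj-irr G f (inj₂ u) = irref G u

C : ∀ {n} → Graph n → (Fin n → Fin n) → Graph (n + n)
C {n} G f = record
  { adj   = λ i j → funAdj G f (splitAt n i) (splitAt n j)
  ; sym   = λ i j → funAdj-sym G f (splitAt n i) (splitAt n j)
  ; irref = λ i → funAdj-irr G f (splitAt n i)
  }

module Submission where

open import Defs
open import Data.Nat using (ℕ; _≤_; _∸_; _*_)
open import Data.Fin using (Fin)
open import Data.Product using (_×_; ∃-syntax; Σ-syntax)

-- If a vertex has three distinct neighbours (a claw), then for
-- every landmark s two of these four vertices are equidistant from s, since
-- their distances lie in {d - 1, d, d + 1}; so one landmark never suffices.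
-- C(G, f) has a claw at ι₁ u for any vertex u of degree at least two in G.  Deleting three vertices a, b, c leaves a resolving set when
-- each pair among them is separated by a neighbour outside {a, b, c}; a case
-- analysis on f produces such a triple.  C(P_n, id) is resolved by its two ends, whose distances are
-- explicit potentials; in C(K_n, constant) twin classes force every resolving
-- set to contain all but three vertices.

open import Data.Nat as ℕ using (zero; suc; _+_; _<_; z≤n; s≤s; _≤?_)
open import Data.Nat.Properties
  using (module ≤-Reasoning; ≤-refl; ≤-reflexive; ≤-trans; ≤-antisym; n≤1+n; ≰⇒>; <-cmp;
         suc-injective; +-identityʳ; +-comm; +-monoʳ-≤; 1+n≢n; m≢1+n+m;
         m≤n+m∸n; m≤n+o⇒m∸n≤o; m+n≤o⇒m≤o∸n)
open import Data.Fin using (zero; suc; toℕ; inject₁; _↑ˡ_; _↑ʳ_; splitAt; fromℕ; fromℕ<)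
open import Data.Fin.Properties
  using (_≟_; any?; all?; ¬∀⟶∃¬; ¬∀⟶∃¬-smallest; toℕ-fromℕ; toℕ-fromℕ<; toℕ-inject;
         toℕ-inject₁; toℕ-injective; splitAt-↑ˡ; splitAt-↑ʳ; splitAt⁻¹-↑ˡ; splitAt⁻¹-↑ʳ;
         ↑ˡ-injective; ↑ʳ-injective)
open import Data.Fin.Subset using (Subset; _∈_; _∉_; ∣_∣; ⊤; ∁; ⁅_⁆; _∪_; inside; outside)
open import Data.Fin.Subset.Properties
  using (_∈?_; ∈⊤; ∣⊤∣≡n; ∣⊥∣≡0; ∣∁p∣≡n∸∣p∣; x∈∁p⇒x∉p; Empty-unique;
         x∈p∪q⁺; x∈p∪q⁻; x∈⁅x⁆; x∈⁅y⁆⇒x≡y)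
open import Data.List using (List; []; _∷_; length)
open import Data.List.Membership.Propositional using () renaming (_∈_ to _∈ₗ_)
open import Data.List.Relation.Unary.Any using (here; there)
open import Data.Vec using (_∷_; here; there)
open import Data.Product using (_,_; proj₁; proj₂)
open import Data.Sum using (_⊎_; inj₁; inj₂; [_,_])
open import Data.Empty using (⊥; ⊥-elim)
open import Data.Bool as Bool using (true; false; not; _∨_)
open import Data.Bool.Properties using (∨-comm; ∨-zeroʳ)
open import Function using (id; case_of_)
open import Relation.Nullary using (¬_; Dec; yes; no; ¬?; contradiction)
open import Relation.Nullary.Decidable
  using (⌊_⌋; isYes≗does; decidable-stable; dec-true; dec-false; map′; _×-dec_; _⊎-dec_)
open import Relation.Binary using (DecidableEquality; tri<; tri≈; tri>)
open import Relation.Binary.PropositionalEquality as ≡ using (_≡_; _≢_; refl; cong; subst; ≢-sym)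

-- Least-number principle: a decidable property of the naturals that holds
-- somewhere has a least witness.  This turns "some walk from x to y" into
-- a distance.

least-witness : {P : ℕ → Set} → (∀ k → Dec (P k)) → ∀ {k} → P k →
                ∃[ m ] (P m × (∀ j → P j → m ≤ j))
least-witness {P} P? {k} pk
  with ¬∀⟶∃¬-smallest (suc k) (λ i → ¬ P (toℕ i)) (λ i → ¬? (P? (toℕ i)))
         (λ none → none (fromℕ k) (subst P (≡.sym (toℕ-fromℕ k)) pk))
... | i , ¬¬pi , below = toℕ i , decidable-stable (P? (toℕ i)) ¬¬pi , minimal
  where
  minimal : ∀ j → P j → toℕ i ≤ j
  minimal j pj with toℕ i ≤? j
  ... | yes i≤j = i≤j
  ... | no i≰j = contradiction (subst P (≡.sym (≡.trans (toℕ-inject j′) (toℕ-fromℕ< j<i))) pj) (below j′)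
    where
    j<i : j < toℕ i
    j<i = ≰⇒> i≰j
    j′ : Fin (toℕ i)
    j′ = fromℕ< j<i

-- Removal of one element is defined
-- by recursion, so that its effect on membership and size is easy to compute;
-- the resulting bound "a subset whose members all occur in a list is no
-- larger than the list" is the counting principle used throughout.

infixl 5 _∖_
_∖_ : ∀ {m} → Subset m → Fin m → Subset m
(_ ∷ p) ∖ zero  = outside ∷ p
(s ∷ p) ∖ suc x = s ∷ (p ∖ x)

∈-∖ : ∀ {m} (p : Subset m) {x y : Fin m} → y ∈ p → y ≢ x → y ∈ p ∖ x
∈-∖ (_ ∷ p) {zero}  {zero}  here        y≢x = contradiction refl y≢x
∈-∖ (_ ∷ p) {zero}  {suc y} (there y∈p) _   = there y∈p
∈-∖ (_ ∷ p) {suc x} {zero}  here        _   = here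
∈-∖ (_ ∷ p) {suc x} {suc y} (there y∈p) y≢x = there (∈-∖ p y∈p (λ y≡x → y≢x (cong suc y≡x)))

∖-⊆ : ∀ {m} (p : Subset m) {x y : Fin m} → y ∈ p ∖ x → y ∈ p
∖-⊆ (_ ∷ p) {zero}  {suc y} (there y∈p) = there y∈p
∖-⊆ (_ ∷ p) {suc x} {zero}  here        = here
∖-⊆ (_ ∷ p) {suc x} {suc y} (there y∈p) = there (∖-⊆ p y∈p)

∖-≢ : ∀ {m} (p : Subset m) {x y : Fin m} → y ∈ p ∖ x → y ≢ x
∖-≢ (_ ∷ p) {zero}  {zero}  ()
∖-≢ (_ ∷ p) {suc x} {suc y} (there y∈p) refl = ∖-≢ p y∈p refl
∖-≢ (_ ∷ p) {zero}  {suc y} _ ()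
∖-≢ (_ ∷ p) {suc x} {zero}  _ ()

∣p∣≤1+∣p∖x∣ : ∀ {m} (p : Subset m) (x : Fin m) → ∣ p ∣ ≤ suc ∣ p ∖ x ∣
∣p∣≤1+∣p∖x∣ (inside  ∷ p) zero    = ≤-refl
∣p∣≤1+∣p∖x∣ (outside ∷ p) zero    = n≤1+n _
∣p∣≤1+∣p∖x∣ (inside  ∷ p) (suc x) = s≤s (∣p∣≤1+∣p∖x∣ p x)
∣p∣≤1+∣p∖x∣ (outside ∷ p) (suc x) = ∣p∣≤1+∣p∖x∣ p x

∣p∖x∣<∣p∣ : ∀ {m} (p : Subset m) {x : Fin m} → x ∈ p → ∣ p ∖ x ∣ < ∣ p ∣
∣p∖x∣<∣p∣ (inside  ∷ p) {zero}  here        = ≤-refl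
∣p∖x∣<∣p∣ (inside  ∷ p) {suc x} (there x∈p) = s≤s (∣p∖x∣<∣p∣ p x∈p)
∣p∖x∣<∣p∣ (outside ∷ p) {suc x} (there x∈p) = ∣p∖x∣<∣p∣ p x∈p

∣p∣≤length : ∀ {m} (p : Subset m) (xs : List (Fin m)) →
             (∀ {x} → x ∈ p → x ∈ₗ xs) → ∣ p ∣ ≤ length xs
∣p∣≤length {m} p [] covered =
  ≤-reflexive (≡.trans (cong ∣_∣ (Empty-unique λ { (x , x∈p) → absurd (covered x∈p) })) (∣⊥∣≡0 m))
  where
  absurd : ∀ {x : Fin m} → ¬ (x ∈ₗ [])
  absurd ()
∣p∣≤length p (y ∷ ys) covered = ≤-trans (∣p∣≤1+∣p∖x∣ p y) (s≤s (∣p∣≤length (p ∖ y) ys covered′))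
  where
  covered′ : ∀ {x} → x ∈ p ∖ y → x ∈ₗ ys
  covered′ x∈p∖y with covered (∖-⊆ p x∈p∖y)
  ... | here x≡y    = contradiction x≡y (∖-≢ p x∈p∖y)
  ... | there x∈ys = x∈ys

complement-bound : ∀ {m} (S : Subset m) (xs : List (Fin m)) →
                   (∀ {x} → x ∉ S → x ∈ₗ xs) → m ∸ length xs ≤ ∣ S ∣
complement-bound {m} S xs covers = m≤n+o⇒m∸n≤o m (length xs) m≤k+∣S∣
  where
  ∣∁S∣≤k : m ∸ ∣ S ∣ ≤ length xs
  ∣∁S∣≤k = subst (_≤ length xs) (∣∁p∣≡n∸∣p∣ S) (∣p∣≤length (∁ S) xs (λ x∈∁S → covers (x∈∁p⇒x∉p x∈∁S)))
  m≤k+∣S∣ : m ≤ length xs + ∣ S ∣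
  m≤k+∣S∣ = subst (m ≤_) (+-comm ∣ S ∣ (length xs))
              (≤-trans (m≤n+m∸n m ∣ S ∣) (+-monoʳ-≤ ∣ S ∣ ∣∁S∣≤k))

representative : ∀ {k} {P : Fin (suc k) → Set} → (∀ x → Dec (P x)) →
                 (∀ {x y} → P x → P y → x ≡ y) → ∃[ a ] (∀ {x} → P x → x ≡ a)
representative P? unique with any? P?
... | yes (a , pa) = a , λ px → unique px pa
... | no none      = zero , λ {x} px → contradiction (x , px) none

two-members : ∀ {m} {S : Subset m} {s s′} → s ∈ S → s′ ∈ S → s ≢ s′ → 2 ≤ ∣ S ∣
two-members {S = S} s∈S s′∈S s≢s′ =
  ≤-trans (s≤s (≤-trans (s≤s z≤n) (∣p∖x∣<∣p∣ (S ∖ _) (∈-∖ S s′∈S (λ e → s≢s′ (≡.sym e))))))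
          (∣p∖x∣<∣p∣ S s∈S)

allBut : ∀ {m} → Fin m → Fin m → Fin m → Subset m
allBut a b c = ⊤ ∖ a ∖ b ∖ c

∈allBut : ∀ {m} {a b c v : Fin m} → v ≢ a → v ≢ b → v ≢ c → v ∈ allBut a b c
∈allBut v≢a v≢b v≢c = ∈-∖ _ (∈-∖ _ (∈-∖ ⊤ ∈⊤ v≢a) v≢b) v≢c

∉allBut : ∀ {m} {a b c v : Fin m} → v ∉ allBut a b c → v ≡ a ⊎ v ≡ b ⊎ v ≡ c
∉allBut {a = a} {b} {c} {v} v∉ with v ≟ a | v ≟ b | v ≟ c
... | yes v≡a | _        | _        = inj₁ v≡a
... | no _    | yes v≡b  | _        = inj₂ (inj₁ v≡b)
... | no _    | no _     | yes v≡c  = inj₂ (inj₂ v≡c)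
... | no v≢a  | no v≢b   | no v≢c   = contradiction (∈allBut v≢a v≢b v≢c) v∉

∣allBut∣ : ∀ {m} {a b c : Fin m} → a ≢ b → a ≢ c → b ≢ c → ∣ allBut a b c ∣ ≤ m ∸ 3
∣allBut∣ {m} {a} {b} {c} a≢b a≢c b≢c = m+n≤o⇒m≤o∸n ∣ allBut a b c ∣ (subst (_≤ m) (+-comm 3 _) 3+∣T∣≤m)
  where
  open ≤-Reasoning
  3+∣T∣≤m : 3 + ∣ allBut a b c ∣ ≤ m
  3+∣T∣≤m = begin
    3 + ∣ allBut a b c ∣ ≤⟨ s≤s (s≤s (∣p∖x∣<∣p∣ (⊤ ∖ a ∖ b) (∈-∖ _ (∈-∖ ⊤ ∈⊤ (≢-sym a≢c)) (≢-sym b≢c)))) ⟩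
    2 + ∣ ⊤ ∖ a ∖ b ∣    ≤⟨ s≤s (∣p∖x∣<∣p∣ (⊤ ∖ a) (∈-∖ ⊤ ∈⊤ (≢-sym a≢b))) ⟩
    1 + ∣ ⊤ ∖ a ∣        ≤⟨ ∣p∖x∣<∣p∣ ⊤ {a} ∈⊤ ⟩
    ∣ ⊤ {m} ∣            ≡⟨ ∣⊤∣≡n m ⟩
    m                    ∎

true≢false : true ≢ false
true≢false ()

⌊⌋-true : ∀ {A : Set} (a? : Dec A) → A → ⌊ a? ⌋ ≡ true
⌊⌋-true a? a = ≡.trans (isYes≗does a?) (dec-true a? a)

⌊⌋-false : ∀ {A : Set} (a? : Dec A) → ¬ A → ⌊ a? ⌋ ≡ false
⌊⌋-false a? ¬a = ≡.trans (isYes≗does a?) (dec-false a? ¬a)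

⌊⌋-true⁻¹ : ∀ {A : Set} (a? : Dec A) → ⌊ a? ⌋ ≡ true → A
⌊⌋-true⁻¹ (yes a) _ = a

module _ {m : ℕ} (H : Graph m) where

  adj⇒≢ : ∀ {x y} → adj H x y ≡ true → x ≢ y
  adj⇒≢ {x} x~y refl = true≢false (≡.trans (≡.sym x~y) (irref H x))

  adj-flip : ∀ {x y} → adj H x y ≡ true → adj H y x ≡ true
  adj-flip {x} {y} x~y = ≡.trans (sym H y x) x~y

  walk? : ∀ x y k → Dec (Walk H x y k)
  walk? x y zero with x ≟ y
  ... | yes refl = yes here
  ... | no x≢y   = no λ { here → x≢y refl }
  walk? x y (suc k) =
    map′ (λ (z , x~z , w) → step x~z w) (λ { (step {y = z} x~z w) → z , x~z , w })
         (any? λ z → (adj H x z Bool.≟ true) ×-dec walk? z y k)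

  crossing-edge : {P : Fin m → Set} → (∀ v → Dec (P v)) → ∀ {x t k} →
                  Walk H x t k → P x → ¬ P t → ∃[ p ] ∃[ q ] (adj H p q ≡ true × P p × ¬ P q)
  crossing-edge P? here px ¬pt = contradiction px ¬pt
  crossing-edge P? (step {x = x} {y = y} x~y w) px ¬pt with P? y
  ... | yes py = crossing-edge P? w py ¬pt
  ... | no ¬py = x , y , x~y , px , ¬py

  potential-distance : (φ : Fin m → ℕ) → (∀ {x y} → adj H x y ≡ true → φ x ≤ suc (φ y)) →
                       ∀ {t v} → φ t ≡ 0 → Walk H v t (φ v) → Dist H v t (φ v)
  potential-distance φ lipschitz {t} {v} φt≡0 w =
    w , λ k w′ → subst (φ v ≤_) (≡.trans (cong (k +_) φt≡0) (+-identityʳ k)) (bound w′)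
    where
    bound : ∀ {x k} → Walk H x t k → φ x ≤ k + φ t
    bound here         = ≤-refl
    bound (step x~y w) = ≤-trans (lipschitz x~y) (s≤s (bound w))

module _ {m : ℕ} {H : Graph m} where

  _++ʷ_ : ∀ {x y z k l} → Walk H x y k → Walk H y z l → Walk H x z (k + l)
  here     ++ʷ w′ = w′
  step e w ++ʷ w′ = step e (w ++ʷ w′)

  reverseʷ : ∀ {x y k} → Walk H x y k → Walk H y x k
  reverseʷ here = here
  reverseʷ {k = suc k} (step {x = x} {y = y} x~y w) =
    subst (Walk H _ x) (+-comm k 1) (reverseʷ w ++ʷ step (adj-flip H x~y) here)

  connected-via-hub : (t : Fin m) → (∀ x → ∃[ k ] Walk H x t k) → Connected H
  connected-via-hub t walk-to-t x y = _ , proj₂ (walk-to-t x) ++ʷ reverseʷ (proj₂ (walk-to-t y))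

Resolves : ∀ {m} → Graph m → Subset m → Fin m → Fin m → Set
Resolves H S x y = ∃[ s ] (s ∈ S × ∃[ a ] ∃[ b ] (Dist H x s a × Dist H y s b × a ≢ b))

Resolves-sym : ∀ {m} {H : Graph m} {S x y} → Resolves H S x y → Resolves H S y x
Resolves-sym (s , s∈S , a , b , da , db , a≢b) = s , s∈S , b , a , db , da , ≢-sym a≢b

module Distance {m : ℕ} (H : Graph m) (conn : Connected H) where

  dist : Fin m → Fin m → ℕ
  dist x y = proj₁ (least-witness (walk? H x y) (proj₂ (conn x y)))

  dist-isDist : ∀ x y → Dist H x y (dist x y)
  dist-isDist x y = proj₂ (least-witness (walk? H x y) (proj₂ (conn x y)))

  Dist⇒≡dist : ∀ {x y k} → Dist H x y k → k ≡ dist x y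
  Dist⇒≡dist {x} {y} (w , minimal) =
    ≤-antisym (minimal _ (proj₁ (dist-isDist x y))) (proj₂ (dist-isDist x y) _ w)

  dist-self : ∀ x → dist x x ≡ 0
  dist-self x = ≡.sym (Dist⇒≡dist (here , λ _ _ → z≤n))

  dist≡0⇒≡ : ∀ {x y} → dist x y ≡ 0 → x ≡ y
  dist≡0⇒≡ {x} {y} d≡0 with subst (Walk H x y) d≡0 (proj₁ (dist-isDist x y))
  ... | here = refl

  dist-adjacent : ∀ {x y} → adj H x y ≡ true → dist x y ≡ 1
  dist-adjacent {x} {y} x~y = ≡.sym (Dist⇒≡dist (step x~y here , minimal))
    where
    minimal : ∀ k → Walk H x y k → 1 ≤ k
    minimal zero    here = contradiction refl (adj⇒≢ H x~y)
    minimal (suc k) _    = s≤s z≤n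

  dist≡1⇒adjacent : ∀ {x y} → dist x y ≡ 1 → adj H x y ≡ true
  dist≡1⇒adjacent {x} {y} d≡1 with subst (Walk H x y) d≡1 (proj₁ (dist-isDist x y))
  ... | step x~y here = x~y

  dist-minimal : ∀ {x y k} → Walk H x y k → dist x y ≤ k
  dist-minimal {x} {y} w = proj₂ (dist-isDist x y) _ w

  dist-step : ∀ {x y} s → adj H x y ≡ true → dist x s ≤ suc (dist y s)
  dist-step {y = y} s x~y = dist-minimal (step x~y (proj₁ (dist-isDist y s)))

  resolves-by-dist : ∀ {S x y s} → s ∈ S → dist x s ≢ dist y s → Resolves H S x y
  resolves-by-dist {x = x} {y} {s} s∈S ≢ = s , s∈S , _ , _ , dist-isDist x s , dist-isDist y s , ≢

  member-resolves : ∀ {S x y} → x ∈ S → x ≢ y → Resolves H S x y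
  member-resolves {x = x} x∈S x≢y =
    resolves-by-dist x∈S λ d≡ → x≢y (≡.sym (dist≡0⇒≡ (≡.trans (≡.sym d≡) (dist-self x))))

  neighbour-resolves : ∀ {S x y s} → s ∈ S → adj H s x ≡ true → adj H s y ≡ false → Resolves H S x y
  neighbour-resolves s∈S s~x s≁y = resolves-by-dist s∈S λ dx≡dy →
    let s~y = adj-flip H (dist≡1⇒adjacent (≡.trans (≡.sym dx≡dy) (dist-adjacent (adj-flip H s~x))))
    in true≢false (≡.trans (≡.sym s~y) s≁y)

  -- Pairs with a member of S are resolved automatically, so only pairs of
  -- vertices outside S need to be checked.
  resolving-if-outside-pairs : ∀ {S} → (∀ {x y} → x ∉ S → y ∉ S → x ≢ y → Resolves H S x y) → Resolving H S
  resolving-if-outside-pairs {S} pairs x y x≢y with x ∈? S | y ∈? S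
  ... | yes x∈S | _       = member-resolves x∈S x≢y
  ... | no _    | yes y∈S = Resolves-sym (member-resolves y∈S (≢-sym x≢y))
  ... | no x∉S  | no y∉S  = pairs x∉S y∉S x≢y

-- Only two numbers differ from d by exactly one, so among three of them two
-- coincide.  This is the pigeonhole step behind the lower bound.

OffByOne : ℕ → ℕ → Set
OffByOne d a = a ≡ suc d ⊎ suc a ≡ d

off-by-one : ∀ {a d} → a ≤ suc d → d ≤ suc a → a ≢ d → OffByOne d a
off-by-one {a} {d} a≤1+d d≤1+a a≢d with <-cmp a d
... | tri< a<d _ _ = inj₂ (≤-antisym a<d d≤1+a)
... | tri≈ _ a≡d _ = contradiction a≡d a≢d
... | tri> _ _ d<a = inj₁ (≤-antisym a≤1+d d<a)

two-of-three : ∀ {d a b c} → OffByOne d a → OffByOne d b → OffByOne d c → a ≡ b ⊎ a ≡ c ⊎ b ≡ c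
two-of-three (inj₁ a≡) (inj₁ b≡) _         = inj₁ (≡.trans a≡ (≡.sym b≡))
two-of-three (inj₂ a≡) (inj₂ b≡) _         = inj₁ (suc-injective (≡.trans a≡ (≡.sym b≡)))
two-of-three (inj₁ a≡) (inj₂ _)  (inj₁ c≡) = inj₂ (inj₁ (≡.trans a≡ (≡.sym c≡)))
two-of-three (inj₁ _)  (inj₂ b≡) (inj₂ c≡) = inj₂ (inj₂ (suc-injective (≡.trans b≡ (≡.sym c≡))))
two-of-three (inj₂ _)  (inj₁ b≡) (inj₁ c≡) = inj₂ (inj₂ (≡.trans b≡ (≡.sym c≡)))
two-of-three (inj₂ a≡) (inj₁ _)  (inj₂ c≡) = inj₂ (inj₁ (suc-injective (≡.trans a≡ (≡.sym c≡))))

metric-dimension : ∀ {m} (H : Graph m) {d} → ∃[ S ] (Resolving H S × ∣ S ∣ ≤ d) →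
                   (∀ S → Resolving H S → d ≤ ∣ S ∣) → IsMetricDim H d
metric-dimension H (S , R , ∣S∣≤d) lower = (S , R , ≤-antisym ∣S∣≤d (lower S R)) , lower

module Resolution {m : ℕ} (H : Graph m) (conn : Connected H) where

  open Distance H conn

  Twins : Fin m → Fin m → Set
  Twins x y = ∀ w → w ≢ x → w ≢ y → adj H x w ≡ adj H y w

  -- The first step of a walk from x can be redirected to start at its twin y.
  twin-dist≤ : ∀ {x y s} → Twins x y → s ≢ x → ∀ {k} → Walk H x s k → dist y s ≤ k
  twin-dist≤ tw s≢x here = contradiction refl s≢x
  twin-dist≤ {y = y} tw s≢x (step {y = w} x~w rest) with w ≟ y
  ... | yes refl = ≤-trans (dist-minimal rest) (n≤1+n _)
  ... | no w≢y   = dist-minimal (step (≡.trans (≡.sym (tw w (≢-sym (adj⇒≢ H x~w)) w≢y)) x~w) rest)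

  twins-equidistant : ∀ {x y s} → Twins x y → s ≢ x → s ≢ y → dist x s ≡ dist y s
  twins-equidistant {x} {y} {s} tw s≢x s≢y =
    ≤-antisym (twin-dist≤ (λ w w≢y w≢x → ≡.sym (tw w w≢x w≢y)) s≢y (proj₁ (dist-isDist y s)))
              (twin-dist≤ tw s≢x (proj₁ (dist-isDist x s)))

  twins-outside : ∀ {S x y} → Resolving H S → Twins x y → x ∉ S → y ∉ S → x ≡ y
  twins-outside {S} {x} {y} R tw x∉S y∉S with x ≟ y
  ... | yes x≡y = x≡y
  ... | no x≢y with R x y x≢y
  ... | s , s∈S , a , b , da , db , a≢b = contradiction a≡b a≢b
    where
    open ≡.≡-Reasoning
    outside≢s : ∀ {v} → v ∉ S → s ≢ v
    outside≢s v∉S s≡v = v∉S (subst (_∈ S) s≡v s∈S)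
    a≡b : a ≡ b
    a≡b = begin
      a        ≡⟨ Dist⇒≡dist da ⟩
      dist x s ≡⟨ twins-equidistant tw (outside≢s x∉S) (outside≢s y∉S) ⟩
      dist y s ≡⟨ ≡.sym (Dist⇒≡dist db) ⟩
      b        ∎

  record Claw : Set where
    field
      centre leaf₁ leaf₂ leaf₃ : Fin m
      centre~leaf₁ : adj H centre leaf₁ ≡ true
      centre~leaf₂ : adj H centre leaf₂ ≡ true
      centre~leaf₃ : adj H centre leaf₃ ≡ true
      leaf₁≢leaf₂  : leaf₁ ≢ leaf₂
      leaf₁≢leaf₃  : leaf₁ ≢ leaf₃
      leaf₂≢leaf₃  : leaf₂ ≢ leaf₃

  leaf-off-by-one : ∀ {u v} s → adj H u v ≡ true → dist v s ≢ dist u s → OffByOne (dist u s) (dist v s)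
  leaf-off-by-one s u~v ≢ = off-by-one (dist-step s (adj-flip H u~v)) (dist-step s u~v) ≢

  module _ (claw : Claw) where

    open Claw claw

    -- Every vertex s sees two distinct vertices of a claw at the same distance:
    -- the four distances from s lie among the three values d - 1, d, d + 1,
    -- where d is the distance from the centre.
    equidistant-pair : ∀ s → ∃[ x ] ∃[ y ] (x ≢ y × dist x s ≡ dist y s)
    equidistant-pair s
      with dist leaf₁ s ℕ.≟ dist centre s | dist leaf₂ s ℕ.≟ dist centre s | dist leaf₃ s ℕ.≟ dist centre s
    ... | yes d₁≡d | _        | _        = leaf₁ , centre , ≢-sym (adj⇒≢ H centre~leaf₁) , d₁≡d
    ... | no _     | yes d₂≡d | _        = leaf₂ , centre , ≢-sym (adj⇒≢ H centre~leaf₂) , d₂≡d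
    ... | no _     | no _     | yes d₃≡d = leaf₃ , centre , ≢-sym (adj⇒≢ H centre~leaf₃) , d₃≡d
    ... | no d₁≢d  | no d₂≢d  | no d₃≢d
      with two-of-three (leaf-off-by-one s centre~leaf₁ d₁≢d) (leaf-off-by-one s centre~leaf₂ d₂≢d)
                        (leaf-off-by-one s centre~leaf₃ d₃≢d)
    ... | inj₁ d₁≡d₂        = leaf₁ , leaf₂ , leaf₁≢leaf₂ , d₁≡d₂
    ... | inj₂ (inj₁ d₁≡d₃) = leaf₁ , leaf₃ , leaf₁≢leaf₃ , d₁≡d₃
    ... | inj₂ (inj₂ d₂≡d₃) = leaf₂ , leaf₃ , leaf₂≢leaf₃ , d₂≡d₃

    -- Hence a single vertex never resolves a graph with a claw: a resolving set
    -- contains some s, and the pair equidistant from s needs a second landmark.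
    claw⇒two-landmarks : ∀ S → Resolving H S → 2 ≤ ∣ S ∣
    claw⇒two-landmarks S R with R centre leaf₁ (adj⇒≢ H centre~leaf₁)
    ... | s , s∈S , _ with equidistant-pair s
    ... | x , y , x≢y , dx≡dy with R x y x≢y
    ... | s′ , s′∈S , a , b , da , db , a≢b =
      two-members s∈S s′∈S λ { refl →
        a≢b (≡.trans (Dist⇒≡dist da) (≡.trans dx≡dy (≡.sym (Dist⇒≡dist db)))) }

  NeighbourSeparated : Subset m → Fin m → Fin m → Set
  NeighbourSeparated S x y = ∃[ s ] (s ∈ S × adj H s x ≡ true × adj H s y ≡ false)

  separated⇒resolves : ∀ {S x y} → NeighbourSeparated S x y → Resolves H S x y
  separated⇒resolves (s , s∈S , s~x , s≁y) = neighbour-resolves s∈S s~x s≁y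

  separated⇒≢ : ∀ {S x y} → NeighbourSeparated S x y → x ≢ y
  separated⇒≢ (s , _ , s~x , s≁y) refl = true≢false (≡.trans (≡.sym s~x) s≁y)

  three-separated⇒resolving-set : ∀ {a b c} →
    NeighbourSeparated (allBut a b c) a b → NeighbourSeparated (allBut a b c) a c →
    NeighbourSeparated (allBut a b c) b c → ∃[ S ] (Resolving H S × ∣ S ∣ ≤ m ∸ 3)
  three-separated⇒resolving-set {a} {b} {c} ab ac bc =
    allBut a b c ,
    resolving-if-outside-pairs (λ x∉ y∉ → resolves-within (∉allBut x∉) (∉allBut y∉)) ,
    ∣allBut∣ (separated⇒≢ ab) (separated⇒≢ ac) (separated⇒≢ bc)
    where
    resolves-within : ∀ {x y} → x ≡ a ⊎ x ≡ b ⊎ x ≡ c → y ≡ a ⊎ y ≡ b ⊎ y ≡ c → x ≢ y →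
                      Resolves H (allBut a b c) x y
    resolves-within (inj₁ refl)        (inj₂ (inj₁ refl)) _ = separated⇒resolves ab
    resolves-within (inj₁ refl)        (inj₂ (inj₂ refl)) _ = separated⇒resolves ac
    resolves-within (inj₂ (inj₁ refl)) (inj₂ (inj₂ refl)) _ = separated⇒resolves bc
    resolves-within (inj₂ (inj₁ refl)) (inj₁ refl)        _ = Resolves-sym (separated⇒resolves ab)
    resolves-within (inj₂ (inj₂ refl)) (inj₁ refl)        _ = Resolves-sym (separated⇒resolves ac)
    resolves-within (inj₂ (inj₂ refl)) (inj₂ (inj₁ refl)) _ = Resolves-sym (separated⇒resolves bc)
    resolves-within (inj₁ refl)        (inj₁ refl)        x≢x = contradiction refl x≢x
    resolves-within (inj₂ (inj₁ refl)) (inj₂ (inj₁ refl)) x≢x = contradiction refl x≢x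
    resolves-within (inj₂ (inj₂ refl)) (inj₂ (inj₂ refl)) x≢x = contradiction refl x≢x

third-vertex : ∀ {n} → 3 ≤ n → (x y : Fin n) → ∃[ z ] (z ≢ x × z ≢ y)
third-vertex (s≤s (s≤s (s≤s _))) x y with zero ≟ x | zero ≟ y
... | no 0≢x   | no 0≢y = zero , 0≢x , 0≢y
... | yes refl | _ with suc zero ≟ y
...   | no 1≢y   = suc zero , (λ ()) , 1≢y
...   | yes refl = suc (suc zero) , (λ ()) , (λ ())
third-vertex (s≤s (s≤s (s≤s _))) x y | no _ | yes refl with suc zero ≟ x
...   | no 1≢x   = suc zero , 1≢x , (λ ())
...   | yes refl = suc (suc zero) , (λ ()) , (λ ())

module _ {n : ℕ} (G : Graph n) (conn : Connected G) where

  -- A vertex with some other vertex in the graph has a neighbour: the walk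
  -- between them leaves it along an edge.
  has-neighbour : ∀ {p t} → t ≢ p → ∃[ q ] adj G p q ≡ true
  has-neighbour {p} {t} t≢p with crossing-edge G (_≟ p) (proj₂ (conn p t)) refl t≢p
  ... | .p , q , p~q , refl , _ = q , p~q

  -- Take a neighbour w of 0 and a vertex t′ ∉ {0, w}; the walk from 0 to t′
  -- leaves {0, w} along an edge, giving 0 or w a second neighbour.
  vertex-of-degree-two : 3 ≤ n → ∃[ u ] ∃[ w ] ∃[ w′ ] (adj G u w ≡ true × adj G u w′ ≡ true × w ≢ w′)
  vertex-of-degree-two 3≤n@(s≤s _) with third-vertex 3≤n zero zero
  ... | t , t≢0 , _ with has-neighbour t≢0
  ... | w , 0~w with third-vertex 3≤n zero w
  ... | t′ , t′≢0 , t′≢w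
    with crossing-edge G (λ v → (v ≟ zero) ⊎-dec (v ≟ w)) (proj₂ (conn zero t′)) (inj₁ refl)
                     [ t′≢0 , t′≢w ]
  ... | _ , q , p~q , inj₁ refl , q∉ = zero , w , q , 0~w , p~q , λ w≡q → q∉ (inj₂ (≡.sym w≡q))
  ... | _ , q , p~q , inj₂ refl , q∉ = w , zero , q , adj-flip G 0~w , p~q , λ 0≡q → q∉ (inj₁ (≡.sym 0≡q))

  dichromatic-edge : {B : Set} → DecidableEquality B → (f : Fin n → B) →
                     ∀ {x y} → f x ≢ f y → ∃[ a ] ∃[ b ] (adj G a b ≡ true × f a ≢ f b)
  dichromatic-edge _≟B_ f {x} {y} fx≢fy
    with crossing-edge G (λ v → f v ≟B f x) (proj₂ (conn x y)) refl (≢-sym fx≢fy)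
  ... | a , b , a~b , fa≡fx , fb≢fx = a , b , a~b , λ fa≡fb → fb≢fx (≡.trans (≡.sym fa≡fb) fa≡fx)

module Functigraph {n : ℕ} (G : Graph n) (f : Fin n → Fin n) where

  H : Graph (n + n)
  H = C G f

  ι₁ ι₂ : Fin n → Fin (n + n)
  ι₁ x = x ↑ˡ n
  ι₂ y = n ↑ʳ y

  adj₁₁ : ∀ x y → adj H (ι₁ x) (ι₁ y) ≡ adj G x y
  adj₁₁ x y rewrite splitAt-↑ˡ n x n | splitAt-↑ˡ n y n = refl

  adj₂₂ : ∀ x y → adj H (ι₂ x) (ι₂ y) ≡ adj G x y
  adj₂₂ x y rewrite splitAt-↑ʳ n n x | splitAt-↑ʳ n n y = refl

  adj₁₂ : ∀ x y → adj H (ι₁ x) (ι₂ y) ≡ ⌊ f x ≟ y ⌋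
  adj₁₂ x y rewrite splitAt-↑ˡ n x n | splitAt-↑ʳ n n y = refl

  adj₂₁ : ∀ y x → adj H (ι₂ y) (ι₁ x) ≡ ⌊ f x ≟ y ⌋
  adj₂₁ y x rewrite splitAt-↑ˡ n x n | splitAt-↑ʳ n n y = refl

  edge₁₂ : ∀ {x y} → f x ≡ y → adj H (ι₁ x) (ι₂ y) ≡ true
  edge₁₂ {x} {y} fx≡y = ≡.trans (adj₁₂ x y) (⌊⌋-true (f x ≟ y) fx≡y)

  edge₂₁ : ∀ {x y} → f x ≡ y → adj H (ι₂ y) (ι₁ x) ≡ true
  edge₂₁ {x} {y} fx≡y = ≡.trans (adj₂₁ y x) (⌊⌋-true (f x ≟ y) fx≡y)

  non-edge₁₂ : ∀ {x y} → f x ≢ y → adj H (ι₁ x) (ι₂ y) ≡ false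
  non-edge₁₂ {x} {y} fx≢y = ≡.trans (adj₁₂ x y) (⌊⌋-false (f x ≟ y) fx≢y)

  non-edge₂₁ : ∀ {x y} → f x ≢ y → adj H (ι₂ y) (ι₁ x) ≡ false
  non-edge₂₁ {x} {y} fx≢y = ≡.trans (adj₂₁ y x) (⌊⌋-false (f x ≟ y) fx≢y)

  ι₁≢ι₂ : ∀ {x y} → ι₁ x ≢ ι₂ y
  ι₁≢ι₂ {x} {y} e with ≡.trans (≡.sym (splitAt-↑ˡ n x n)) (≡.trans (cong (splitAt n) e) (splitAt-↑ʳ n n y))
  ... | ()

  ι₂≢ι₁ : ∀ {x y} → ι₂ y ≢ ι₁ x
  ι₂≢ι₁ e = ι₁≢ι₂ (≡.sym e)

  ι₁-injective : ∀ {x y} → ι₁ x ≡ ι₁ y → x ≡ y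
  ι₁-injective = ↑ˡ-injective n _ _

  ι₂-injective : ∀ {x y} → ι₂ x ≡ ι₂ y → x ≡ y
  ι₂-injective = ↑ʳ-injective n _ _

  ι₁-≢ : ∀ {x y} → x ≢ y → ι₁ x ≢ ι₁ y
  ι₁-≢ x≢y e = x≢y (ι₁-injective e)

  ι₂-≢ : ∀ {x y} → x ≢ y → ι₂ x ≢ ι₂ y
  ι₂-≢ x≢y e = x≢y (ι₂-injective e)

  data View : Fin (n + n) → Set where
    in₁ : ∀ x → View (ι₁ x)
    in₂ : ∀ y → View (ι₂ y)

  view : ∀ v → View v
  view v with splitAt n v in eq
  ... | inj₁ x = subst View (splitAt⁻¹-↑ˡ eq) (in₁ x)
  ... | inj₂ y = subst View (splitAt⁻¹-↑ʳ eq) (in₂ y)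

  lift₁ : ∀ {x y k} → Walk G x y k → Walk H (ι₁ x) (ι₁ y) k
  lift₁ here                              = here
  lift₁ (step {x = x} {y = y} x~y w) = step (≡.trans (adj₁₁ x y) x~y) (lift₁ w)

  lift₂ : ∀ {x y k} → Walk G x y k → Walk H (ι₂ x) (ι₂ y) k
  lift₂ here                              = here
  lift₂ (step {x = x} {y = y} x~y w) = step (≡.trans (adj₂₂ x y) x~y) (lift₂ w)

  connected : Connected G → Connected H
  connected conn v w with view v | view w
  ... | in₁ x | in₁ y = _ , lift₁ (proj₂ (conn x y))
  ... | in₂ x | in₂ y = _ , lift₂ (proj₂ (conn x y))
  ... | in₁ x | in₂ y = _ , step (edge₁₂ refl) (lift₂ (proj₂ (conn (f x) y)))
  ... | in₂ y | in₁ x = _ , reverseʷ (step (edge₁₂ refl) (lift₂ (proj₂ (conn (f x) y))))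

  -- A vertex u of G with two neighbours w, w′ gives the claw ι₁ u with leaves
  -- ι₁ w, ι₁ w′ and ι₂ (f u); hence dim C(G, f) ≥ 2.
  module _ (conn : Connected G) (3≤n : 3 ≤ n) where

    open Resolution H (connected conn)

    claw : Claw
    claw with vertex-of-degree-two G conn 3≤n
    ... | u , w , w′ , u~w , u~w′ , w≢w′ = record
      { centre = ι₁ u ; leaf₁ = ι₁ w ; leaf₂ = ι₁ w′ ; leaf₃ = ι₂ (f u)
      ; centre~leaf₁ = ≡.trans (adj₁₁ u w) u~w
      ; centre~leaf₂ = ≡.trans (adj₁₁ u w′) u~w′
      ; centre~leaf₃ = edge₁₂ refl
      ; leaf₁≢leaf₂ = ι₁-≢ w≢w′ ; leaf₁≢leaf₃ = ι₁≢ι₂ ; leaf₂≢leaf₃ = ι₁≢ι₂ }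

    lower-bound : ∀ S → Resolving H S → 2 ≤ ∣ S ∣
    lower-bound = claw⇒two-landmarks claw

    SmallResolvingSet : Set
    SmallResolvingSet = ∃[ S ] (Resolving H S × ∣ S ∣ ≤ (n + n) ∸ 3)

    separator : ∀ {a b c x y} s → s ≢ a → s ≢ b → s ≢ c → adj H s x ≡ true → adj H s y ≡ false →
                NeighbourSeparated (allBut a b c) x y
    separator s s≢a s≢b s≢c s~x s≁y = s , ∈allBut s≢a s≢b s≢c , s~x , s≁y

    -- (I) f takes distinct values on a, b, c.  Remove ι₁ a, ι₁ b, ι₁ c: the pair
    -- ι₁ x, ι₁ y is separated by ι₂ (f x).
    distinct-images : ∀ {a b c} → f a ≢ f b → f a ≢ f c → f b ≢ f c → SmallResolvingSet
    distinct-images {a} {b} {c} fa≢fb fa≢fc fb≢fc =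
      three-separated⇒resolving-set (by-image fa≢fb) (by-image fa≢fc) (by-image fb≢fc)
      where
      by-image : ∀ {x y} → f x ≢ f y → NeighbourSeparated (allBut (ι₁ a) (ι₁ b) (ι₁ c)) (ι₁ x) (ι₁ y)
      by-image fx≢fy = separator (ι₂ _) ι₂≢ι₁ ι₂≢ι₁ ι₂≢ι₁ (edge₂₁ refl) (non-edge₂₁ (≢-sym fx≢fy))

    -- (II) f is constant with value p.  With z a neighbour of p and y ∉ {p, z},
    -- remove ι₂ p, ι₁ p, ι₂ y: the separators are ι₂ z and ι₁ z.
    constant-map : ∀ {p} → (∀ x → f x ≡ p) → SmallResolvingSet
    constant-map {p} const with third-vertex 3≤n p p
    ... | t , t≢p , _ with has-neighbour G conn t≢p
    ... | z , p~z with third-vertex 3≤n p z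
    ... | y , y≢p , y≢z =
      three-separated⇒resolving-set
        (separator (ι₂ z) (ι₂-≢ z≢p) ι₂≢ι₁ (ι₂-≢ (≢-sym y≢z)) (≡.trans (adj₂₂ z p) z~p)
                   (non-edge₂₁ (λ fp≡z → z≢p (≡.trans (≡.sym fp≡z) (const p)))))
        (separator (ι₁ z) ι₁≢ι₂ (ι₁-≢ z≢p) ι₁≢ι₂ (edge₁₂ (const z)) (non-edge₁₂ fz≢y))
        (separator (ι₁ z) ι₁≢ι₂ (ι₁-≢ z≢p) ι₁≢ι₂ (≡.trans (adj₁₁ z p) z~p) (non-edge₁₂ fz≢y))
      where
      z~p : adj G z p ≡ true
      z~p = adj-flip G p~z
      z≢p : z ≢ p
      z≢p = ≢-sym (adj⇒≢ G p~z)
      fz≢y : f z ≢ y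
      fz≢y fz≡y = y≢p (≡.trans (≡.sym fz≡y) (const z))

    -- (III) a ~ b with f a ≢ f b, and c ≢ a with f c = f a.  With y ∉ {f a, f b},
    -- remove ι₁ a, ι₂ (f a), ι₂ y: the separators are ι₁ b and ι₁ c.
    edge-and-repeat : ∀ {a b c} → adj G a b ≡ true → f a ≢ f b → c ≢ a → f c ≡ f a → SmallResolvingSet
    edge-and-repeat {a} {b} {c} a~b fa≢fb c≢a fc≡fa with third-vertex 3≤n (f a) (f b)
    ... | y , y≢fa , y≢fb =
      three-separated⇒resolving-set
        (separator (ι₁ b) (ι₁-≢ b≢a) ι₁≢ι₂ ι₁≢ι₂ b~a (non-edge₁₂ (≢-sym fa≢fb)))
        (separator (ι₁ b) (ι₁-≢ b≢a) ι₁≢ι₂ ι₁≢ι₂ b~a (non-edge₁₂ (≢-sym y≢fb)))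
        (separator (ι₁ c) (ι₁-≢ c≢a) ι₁≢ι₂ ι₁≢ι₂ (edge₁₂ fc≡fa)
                   (non-edge₁₂ λ fc≡y → y≢fa (≡.trans (≡.sym fc≡y) fc≡fa)))
      where
      b~a : adj H (ι₁ b) (ι₁ a) ≡ true
      b~a = ≡.trans (adj₁₁ b a) (adj-flip G a~b)
      b≢a : b ≢ a
      b≢a = ≢-sym (adj⇒≢ G a~b)

    v₀ : Fin n
    v₀ = fromℕ< 3≤n

    -- A non-constant f changes value along some edge a ~ b; a third vertex c
    -- either repeats f a or f b (case III) or has a new value (case I).
    non-constant-map : ∀ {x y} → f x ≢ f y → SmallResolvingSet
    non-constant-map fx≢fy with dichromatic-edge G conn _≟_ f fx≢fy
    ... | a , b , a~b , fa≢fb with third-vertex 3≤n a b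
    ... | c , c≢a , c≢b with f c ≟ f a | f c ≟ f b
    ... | yes fc≡fa | _         = edge-and-repeat a~b fa≢fb c≢a fc≡fa
    ... | no _      | yes fc≡fb = edge-and-repeat (adj-flip G a~b) (≢-sym fa≢fb) c≢b fc≡fb
    ... | no fc≢fa  | no fc≢fb  = distinct-images fa≢fb (≢-sym fc≢fa) (≢-sym fc≢fb)

    upper-bound : SmallResolvingSet
    upper-bound with all? (λ x → f x ≟ f v₀)
    ... | yes constant = constant-map constant
    ... | no ¬constant = non-constant-map (proj₂ (¬∀⟶∃¬ n _ (λ x → f x ≟ f v₀) ¬constant))

-- Sharpness of the upper bound: C(K_n, f) with f constant has dimension
-- 2n - 3.  All vertices of G₁ are pairwise twins, as are the vertices ι₂ y
-- with y ≠ 0; so a resolving set misses at most one vertex of each class,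
-- besides possibly ι₂ 0.

complete : ∀ n → Graph n
complete n = record
  { adj   = λ x y → not ⌊ x ≟ y ⌋
  ; sym   = λ x y → cong not (⌊≟⌋-sym x y)
  ; irref = λ x → cong not (⌊⌋-true (x ≟ x) refl)
  }
  where
  ⌊≟⌋-sym : ∀ (x y : Fin n) → ⌊ x ≟ y ⌋ ≡ ⌊ y ≟ x ⌋
  ⌊≟⌋-sym x y with x ≟ y
  ... | yes refl = ≡.sym (⌊⌋-true (x ≟ x) refl)
  ... | no x≢y   = ≡.sym (⌊⌋-false (y ≟ x) (≢-sym x≢y))

complete-adj : ∀ {n} {x y : Fin n} → x ≢ y → adj (complete n) x y ≡ true
complete-adj {x = x} {y} x≢y = cong not (⌊⌋-false (x ≟ y) x≢y)

complete-connected : ∀ n → Connected (complete n)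
complete-connected n x y with x ≟ y
... | yes refl = 0 , here
... | no x≢y   = 1 , step (complete-adj x≢y) here

-- The order is suc n, so that vertex 0 exists.
module CompleteConstant (n : ℕ) where

  open Functigraph (complete (suc n)) (λ _ → zero)
  open Resolution H (connected (complete-connected (suc n)))

  both-true : ∀ {a b} → a ≡ true → b ≡ true → a ≡ b
  both-true a≡ b≡ = ≡.trans a≡ (≡.sym b≡)

  -- Every vertex of G₁ is adjacent to the rest of G₁ and to ι₂ 0 only.
  twins₁ : ∀ x x′ → Twins (ι₁ x) (ι₁ x′)
  twins₁ x x′ w w≢ w≢′ with view w
  ... | in₁ z = both-true (≡.trans (adj₁₁ x z) (complete-adj λ x≡z → w≢ (cong ι₁ (≡.sym x≡z))))
                          (≡.trans (adj₁₁ x′ z) (complete-adj λ x′≡z → w≢′ (cong ι₁ (≡.sym x′≡z))))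
  ... | in₂ z = ≡.trans (adj₁₂ x z) (≡.sym (adj₁₂ x′ z))

  -- A vertex ι₂ y with y ≠ 0 is adjacent to the rest of G₂ only.
  twins₂ : ∀ {y y′} → y ≢ zero → y′ ≢ zero → Twins (ι₂ y) (ι₂ y′)
  twins₂ {y} {y′} y≢0 y′≢0 w w≢ w≢′ with view w
  ... | in₁ z = ≡.trans (non-edge₂₁ {z} (≢-sym y≢0)) (≡.sym (non-edge₂₁ {z} (≢-sym y′≢0)))
  ... | in₂ z = both-true (≡.trans (adj₂₂ y z) (complete-adj λ y≡z → w≢ (cong ι₂ (≡.sym y≡z))))
                          (≡.trans (adj₂₂ y′ z) (complete-adj λ y′≡z → w≢′ (cong ι₂ (≡.sym y′≡z))))

  lower-bound-complete : ∀ S → Resolving H S → (suc n + suc n) ∸ 3 ≤ ∣ S ∣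
  lower-bound-complete S R = complement-bound S (ι₁ a ∷ ι₂ b ∷ ι₂ zero ∷ []) covered
    where
    first-copy : ∃[ a ] (∀ {x} → ι₁ x ∉ S → x ≡ a)
    first-copy = representative (λ x → ¬? (ι₁ x ∈? S))
      (λ x∉S x′∉S → ι₁-injective (twins-outside R (twins₁ _ _) x∉S x′∉S))
    second-copy : ∃[ b ] (∀ {y} → y ≢ zero × ι₂ y ∉ S → y ≡ b)
    second-copy = representative (λ y → ¬? (y ≟ zero) ×-dec ¬? (ι₂ y ∈? S))
      (λ (y≢0 , y∉S) (y′≢0 , y′∉S) → ι₂-injective (twins-outside R (twins₂ y≢0 y′≢0) y∉S y′∉S))
    a b : Fin (suc n)
    a = proj₁ first-copy
    b = proj₁ second-copy
    covered : ∀ {v} → v ∉ S → v ∈ₗ (ι₁ a ∷ ι₂ b ∷ ι₂ zero ∷ [])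
    covered {v} v∉S with view v
    ... | in₁ x = here (cong ι₁ (proj₂ first-copy v∉S))
    ... | in₂ y with y ≟ zero
    ...   | yes refl = there (there (here refl))
    ...   | no y≢0   = there (here (cong ι₂ (proj₂ second-copy (y≢0 , v∉S))))

  dimension : 3 ≤ suc n → IsMetricDim H ((suc n + suc n) ∸ 3)
  dimension 3≤n = metric-dimension H (upper-bound (complete-connected (suc n)) 3≤n) lower-bound-complete

-- Sharpness of the lower bound: C(P_n, id), the ladder, has dimension 2.
-- The distances to the two ends ι₁ 0 and ι₂ 0 are explicit potentials, and
-- together they determine the vertex.

path : ∀ n → Graph n
path n = record
  { adj   = λ i j → ⌊ suc (toℕ i) ℕ.≟ toℕ j ⌋ ∨ ⌊ suc (toℕ j) ℕ.≟ toℕ i ⌋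
  ; sym   = λ i j → ∨-comm ⌊ suc (toℕ i) ℕ.≟ toℕ j ⌋ _
  ; irref = λ i → cong (λ b → b ∨ b) (⌊⌋-false (suc (toℕ i) ℕ.≟ toℕ i) 1+n≢n)
  }

module _ {n : ℕ} where

  path-edge : ∀ {i j : Fin n} → suc (toℕ j) ≡ toℕ i → adj (path n) i j ≡ true
  path-edge {i} {j} e = ≡.trans (cong (⌊ suc (toℕ i) ℕ.≟ toℕ j ⌋ ∨_) (⌊⌋-true (suc (toℕ j) ℕ.≟ toℕ i) e))
                                (∨-zeroʳ _)

  path-lipschitz : ∀ {i j : Fin n} → adj (path n) i j ≡ true → toℕ i ≤ suc (toℕ j)
  path-lipschitz {i} {j} i~j with suc (toℕ i) ℕ.≟ toℕ j
  ... | yes 1+i≡j = subst (toℕ i ≤_) (cong suc 1+i≡j) (≤-trans (n≤1+n _) (n≤1+n _))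
  ... | no _      = ≤-reflexive (≡.sym (⌊⌋-true⁻¹ (suc (toℕ j) ℕ.≟ toℕ i) i~j))

walk-down : ∀ {n} k (i : Fin (suc n)) → toℕ i ≡ k → Walk (path (suc n)) i zero k
walk-down zero    zero    refl = here
walk-down (suc k) (suc j) i≡k =
  step (path-edge (cong suc (toℕ-inject₁ j)))
       (walk-down k (inject₁ j) (≡.trans (toℕ-inject₁ j) (suc-injective i≡k)))

path-connected : ∀ n → Connected (path (suc n))
path-connected n = connected-via-hub zero (λ i → toℕ i , walk-down _ i refl)

-- The order is suc n, so that the end 0 exists.
module PathIdentity (n : ℕ) where

  open Functigraph (path (suc n)) id

  end₁ end₂ : Fin (suc n + suc n)
  end₁ = ι₁ zero
  end₂ = ι₂ zero

  -- The distance to end₁ (resp. end₂) from a vertex at position i is i on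
  -- its own side and i + 1 on the other side.
  ψ₁ ψ₂ : Fin (suc n) ⊎ Fin (suc n) → ℕ
  ψ₁ (inj₁ i) = toℕ i
  ψ₁ (inj₂ i) = suc (toℕ i)
  ψ₂ (inj₁ i) = suc (toℕ i)
  ψ₂ (inj₂ i) = toℕ i

  φ₁ φ₂ : Fin (suc n + suc n) → ℕ
  φ₁ v = ψ₁ (splitAt (suc n) v)
  φ₂ v = ψ₂ (splitAt (suc n) v)

  ψ₁-lipschitz : ∀ p q → funAdj (path (suc n)) id p q ≡ true → ψ₁ p ≤ suc (ψ₁ q)
  ψ₁-lipschitz (inj₁ i) (inj₁ j) i~j = path-lipschitz i~j
  ψ₁-lipschitz (inj₂ i) (inj₂ j) i~j = s≤s (path-lipschitz i~j)
  ψ₁-lipschitz (inj₁ i) (inj₂ j) i~j with ⌊⌋-true⁻¹ (i ≟ j) i~j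
  ... | refl = ≤-trans (n≤1+n _) (n≤1+n _)
  ψ₁-lipschitz (inj₂ i) (inj₁ j) j~i with ⌊⌋-true⁻¹ (j ≟ i) j~i
  ... | refl = ≤-refl

  ψ₂-lipschitz : ∀ p q → funAdj (path (suc n)) id p q ≡ true → ψ₂ p ≤ suc (ψ₂ q)
  ψ₂-lipschitz (inj₁ i) (inj₁ j) i~j = s≤s (path-lipschitz i~j)
  ψ₂-lipschitz (inj₂ i) (inj₂ j) i~j = path-lipschitz i~j
  ψ₂-lipschitz (inj₁ i) (inj₂ j) i~j with ⌊⌋-true⁻¹ (i ≟ j) i~j
  ... | refl = ≤-refl
  ψ₂-lipschitz (inj₂ i) (inj₁ j) j~i with ⌊⌋-true⁻¹ (j ≟ i) j~i
  ... | refl = ≤-trans (n≤1+n _) (n≤1+n _)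

  φ₁-ι₁ : ∀ i → φ₁ (ι₁ i) ≡ toℕ i
  φ₁-ι₁ i rewrite splitAt-↑ˡ (suc n) i (suc n) = refl

  φ₁-ι₂ : ∀ i → φ₁ (ι₂ i) ≡ suc (toℕ i)
  φ₁-ι₂ i rewrite splitAt-↑ʳ (suc n) (suc n) i = refl

  φ₂-ι₁ : ∀ i → φ₂ (ι₁ i) ≡ suc (toℕ i)
  φ₂-ι₁ i rewrite splitAt-↑ˡ (suc n) i (suc n) = refl

  φ₂-ι₂ : ∀ i → φ₂ (ι₂ i) ≡ toℕ i
  φ₂-ι₂ i rewrite splitAt-↑ʳ (suc n) (suc n) i = refl

  walk-to-end₁ : ∀ v → Walk H v end₁ (φ₁ v)
  walk-to-end₁ v with view v
  ... | in₁ i = subst (Walk H (ι₁ i) end₁) (≡.sym (φ₁-ι₁ i)) (lift₁ (walk-down _ i refl))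
  ... | in₂ i = subst (Walk H (ι₂ i) end₁) (≡.sym (φ₁-ι₂ i)) (step (edge₂₁ {i} refl) (lift₁ (walk-down _ i refl)))

  walk-to-end₂ : ∀ v → Walk H v end₂ (φ₂ v)
  walk-to-end₂ v with view v
  ... | in₁ i = subst (Walk H (ι₁ i) end₂) (≡.sym (φ₂-ι₁ i)) (step (edge₁₂ {i} refl) (lift₂ (walk-down _ i refl)))
  ... | in₂ i = subst (Walk H (ι₂ i) end₂) (≡.sym (φ₂-ι₂ i)) (lift₂ (walk-down _ i refl))

  dist-end₁ : ∀ v → Dist H v end₁ (φ₁ v)
  dist-end₁ v = potential-distance H φ₁ (λ {x} {y} → ψ₁-lipschitz (splitAt (suc n) x) (splitAt (suc n) y))
                                   (φ₁-ι₁ zero) (walk-to-end₁ v)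

  dist-end₂ : ∀ v → Dist H v end₂ (φ₂ v)
  dist-end₂ v = potential-distance H φ₂ (λ {x} {y} → ψ₂-lipschitz (splitAt (suc n) x) (splitAt (suc n) y))
                                   (φ₂-ι₂ zero) (walk-to-end₂ v)

  -- The two potentials together determine the vertex: on opposite sides they
  -- would have to be off by one in opposite directions.
  crossed : ∀ {a b} → a ≡ suc b → suc a ≡ b → ⊥
  crossed {b = b} a≡1+b 1+a≡b = m≢1+n+m b (≡.trans (≡.sym 1+a≡b) (cong suc a≡1+b))

  potentials-injective : ∀ {x y} → φ₁ x ≡ φ₁ y → φ₂ x ≡ φ₂ y → x ≡ y
  potentials-injective {x} {y} e₁ e₂ with view x | view y
  ... | in₁ i | in₁ j = cong ι₁ (toℕ-injective (≡.trans (≡.sym (φ₁-ι₁ i)) (≡.trans e₁ (φ₁-ι₁ j))))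
  ... | in₂ i | in₂ j = cong ι₂ (toℕ-injective (≡.trans (≡.sym (φ₂-ι₂ i)) (≡.trans e₂ (φ₂-ι₂ j))))
  ... | in₁ i | in₂ j = ⊥-elim (crossed (≡.trans (≡.sym (φ₁-ι₁ i)) (≡.trans e₁ (φ₁-ι₂ j)))
                                        (≡.trans (≡.sym (φ₂-ι₁ i)) (≡.trans e₂ (φ₂-ι₂ j))))
  ... | in₂ i | in₁ j = ⊥-elim (crossed (≡.trans (≡.sym (φ₁-ι₁ j)) (≡.trans (≡.sym e₁) (φ₁-ι₂ i)))
                                        (≡.trans (≡.sym (φ₂-ι₁ j)) (≡.trans (≡.sym e₂) (φ₂-ι₂ i))))

  ends : Subset (suc n + suc n)
  ends = ⁅ end₁ ⁆ ∪ ⁅ end₂ ⁆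

  ends-resolving : Resolving H ends
  ends-resolving x y x≢y with φ₁ x ℕ.≟ φ₁ y | φ₂ x ℕ.≟ φ₂ y
  ... | no φ₁x≢φ₁y | _          =
    end₁ , x∈p∪q⁺ {q = ⁅ end₂ ⁆} (inj₁ (x∈⁅x⁆ end₁)) , _ , _ , dist-end₁ x , dist-end₁ y , φ₁x≢φ₁y
  ... | yes _      | no φ₂x≢φ₂y =
    end₂ , x∈p∪q⁺ {p = ⁅ end₁ ⁆} (inj₂ (x∈⁅x⁆ end₂)) , _ , _ , dist-end₂ x , dist-end₂ y , φ₂x≢φ₂y
  ... | yes φ₁x≡φ₁y | yes φ₂x≡φ₂y = contradiction (potentials-injective φ₁x≡φ₁y φ₂x≡φ₂y) x≢y

  ∣ends∣≤2 : ∣ ends ∣ ≤ 2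
  ∣ends∣≤2 = ∣p∣≤length ends (end₁ ∷ end₂ ∷ []) λ v∈ends → case x∈p∪q⁻ ⁅ end₁ ⁆ ⁅ end₂ ⁆ v∈ends of λ
    { (inj₁ v∈⁅end₁⁆) → here (x∈⁅y⁆⇒x≡y end₁ v∈⁅end₁⁆)
    ; (inj₂ v∈⁅end₂⁆) → there (here (x∈⁅y⁆⇒x≡y end₂ v∈⁅end₂⁆)) }

  dimension : 3 ≤ suc n → IsMetricDim H 2
  dimension 3≤n = metric-dimension H (ends , ends-resolving , ∣ends∣≤2)
                                     (lower-bound (path-connected n) 3≤n)

-- C(G, f) has n + n vertices, which the statement writes as 2 * n.
2*n≡n+n : ∀ n → 2 * n ≡ n + n
2*n≡n+n n = cong (n +_) (+-identityʳ n)

theorem2p4 :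
    (∀ (n : ℕ) → 3 ≤ n → (G : Graph n) → Connected G → (f : Fin n → Fin n) →
      ∀ d → IsMetricDim (C G f) d → 2 ≤ d × d ≤ 2 * n ∸ 3)
    ×
    (∀ (n : ℕ) → 3 ≤ n →
      (Σ[ G ∈ Graph n ] Σ[ f ∈ (Fin n → Fin n) ] (Connected G × IsMetricDim (C G f) 2))
      × (Σ[ G ∈ Graph n ] Σ[ f ∈ (Fin n → Fin n) ] (Connected G × IsMetricDim (C G f) (2 * n ∸ 3))))
theorem2p4 = bounds , sharpness
  where
  bounds : ∀ (n : ℕ) → 3 ≤ n → (G : Graph n) → Connected G → (f : Fin n → Fin n) →
           ∀ d → IsMetricDim (C G f) d → 2 ≤ d × d ≤ 2 * n ∸ 3
  bounds n 3≤n G conn f d ((S , R , ∣S∣≡d) , minimal) with Functigraph.upper-bound G f conn 3≤n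
  ... | S′ , R′ , ∣S′∣≤2n-3 =
    subst (2 ≤_) ∣S∣≡d (Functigraph.lower-bound G f conn 3≤n S R) ,
    ≤-trans (minimal S′ R′) (subst (λ k → ∣ S′ ∣ ≤ k ∸ 3) (≡.sym (2*n≡n+n n)) ∣S′∣≤2n-3)

  sharpness : ∀ (n : ℕ) → 3 ≤ n →
    (Σ[ G ∈ Graph n ] Σ[ f ∈ (Fin n → Fin n) ] (Connected G × IsMetricDim (C G f) 2))
    × (Σ[ G ∈ Graph n ] Σ[ f ∈ (Fin n → Fin n) ] (Connected G × IsMetricDim (C G f) (2 * n ∸ 3)))
  sharpness (suc n) 3≤n =
    (path (suc n) , id , path-connected n , PathIdentity.dimension n 3≤n) ,
    (complete (suc n) , (λ _ → zero) , complete-connected (suc n) ,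
     subst (λ k → IsMetricDim (C (complete (suc n)) (λ _ → zero)) (k ∸ 3)) (≡.sym (2*n≡n+n (suc n)))
           (CompleteConstant.dimension n 3≤n))
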